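{- For any connected, simple, locally finite graphs $G$ and $H$, $A_1(G\times H)\cong A_1(G)\times A_1(H)$, where $G\times H$ denotes the Cartesian product graph.
   Context: Graph maps: functions on vertices sending equal-or-adjacent vertices to equal-or-adjacent vertices; $\mathbb{Z}$ is the path graph on the integers, $I_m$ its induced subgraph on $\{0,\dots,m\}$. The discrete fundamental group $A_1(K)=A_1(K,v_0)$ consists of based homotopy classes of graph maps $f:\mathbb{Z}\to K$ with $f(i)=v_0$ for $|i|\ge r_f$, where a based homotopy from $f$ to $g$ is a graph map $h:\mathbb{Z}\times I_m\to K$ with $h(\cdot,0)=f$, $h(\cdot,m)=g$ and every $h(\cdot,j)$ such a based map; the product is concatenation $p(i)=f(i+r_f)$ ($i\le0$), $p(i)=g(i-r_g)$ ($i\ge0$). For connected $K$ it is independent of base vertex. -}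

module Defs where

open import Level using (Level; _⊔_; 0ℓ) renaming (suc to lsuc)
open import Data.Nat as ℕ using (ℕ; _≤_)
open import Data.Integer as ℤ using (ℤ; +_; ∣_∣; _≤ᵇ_)
open import Data.Fin using (Fin; toℕ; fromℕ)
open import Data.Bool using (if_then_else_)
open import Data.Product using (Σ; _×_; _,_; ∃; ∃-syntax; proj₁; proj₂)
open import Data.Sum using (_⊎_)
open import Data.List using (List)
open import Data.List.Membership.Propositional using (_∈_)
open import Relation.Nullary using (¬_)
open import Relation.Binary.PropositionalEquality using (_≡_)
open import Function.Bundles using (_⇔_)

record Graph (v e : Level) : Set (lsuc (v ⊔ e)) where
  field
    Vertex : Set v
    _~_    : Vertex → Vertex → Set e
open Graph public

EqAdj : ∀ {v e} (G : Graph v e) → Vertex G → Vertex G → Set (v ⊔ e)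
EqAdj G x y = (x ≡ y) ⊎ _~_ G x y

IsGraphMap : ∀ {v e v' e'} (G : Graph v e) (K : Graph v' e') →
             (Vertex G → Vertex K) → Set (v ⊔ e ⊔ v' ⊔ e')
IsGraphMap G K f = ∀ x y → EqAdj G x y → EqAdj K (f x) (f y)

GraphMap : ∀ {v e v' e'} (G : Graph v e) (K : Graph v' e') → Set (v ⊔ e ⊔ v' ⊔ e')
GraphMap G K = Σ (Vertex G → Vertex K) (IsGraphMap G K)

IsSimple : ∀ {v e} → Graph v e → Set (v ⊔ e)
IsSimple G = (∀ x → ¬ (_~_ G x x)) × (∀ x y → _~_ G x y → _~_ G y x)

IsLocallyFinite : ∀ {v e} → Graph v e → Set (v ⊔ e)
IsLocallyFinite G = ∀ x → ∃[ ns ] (∀ y → (_~_ G x y ⇔ (y ∈ ns)))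

ℤG : Graph 0ℓ 0ℓ
ℤG = record { Vertex = ℤ ; _~_ = λ i j → (j ≡ i ℤ.+ ℤ.1ℤ) ⊎ (i ≡ j ℤ.+ ℤ.1ℤ) }

I : ℕ → Graph 0ℓ 0ℓ
I m = record { Vertex = Fin (ℕ.suc m)
             ; _~_ = λ j k → (toℕ k ≡ ℕ.suc (toℕ j)) ⊎ (toℕ j ≡ ℕ.suc (toℕ k)) }

_□_ : ∀ {v e v' e'} → Graph v e → Graph v' e' → Graph (v ⊔ v') (v ⊔ e ⊔ v' ⊔ e')
G □ H = record
  { Vertex = Vertex G × Vertex H
  ; _~_ = λ p q → (_~_ G (proj₁ p) (proj₁ q) × proj₂ p ≡ proj₂ q)
                ⊎ (proj₁ p ≡ proj₁ q × _~_ H (proj₂ p) (proj₂ q)) }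

IsConnected : ∀ {v e} → Graph v e → Set (v ⊔ e)
IsConnected G = ∀ x y → ∃[ m ] Σ (GraphMap (I m) G) λ p →
                  (proj₁ p Data.Fin.zero ≡ x) × (proj₁ p (fromℕ m) ≡ y)

BasedWithRadius : ∀ {v e} (K : Graph v e) (v₀ : Vertex K) → (ℤ → Vertex K) → ℕ → Set v
BasedWithRadius K v₀ f r = ∀ i → r ≤ ∣ i ∣ → f i ≡ v₀

IsBased : ∀ {v e} (K : Graph v e) (v₀ : Vertex K) → (ℤ → Vertex K) → Set v
IsBased K v₀ f = ∃[ r ] BasedWithRadius K v₀ f r

record Loop {v e} (K : Graph v e) (v₀ : Vertex K) : Set (v ⊔ e) where
  field
    fn     : ℤ → Vertex K
    isMap  : IsGraphMap ℤG K fn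
    radius : ℕ
    based  : BasedWithRadius K v₀ fn radius
open Loop public

BasedHomotopic : ∀ {v e} (K : Graph v e) (v₀ : Vertex K) →
                 (ℤ → Vertex K) → (ℤ → Vertex K) → Set (v ⊔ e)
BasedHomotopic K v₀ f g =
  ∃[ m ] Σ (GraphMap (ℤG □ I m) K) λ h →
      (∀ j → IsBased K v₀ (λ i → proj₁ h (i , j)))
    × (∀ i → proj₁ h (i , Data.Fin.zero) ≡ f i)
    × (∀ i → proj₁ h (i , fromℕ m) ≡ g i)

-- homotopy of loops (the equivalence relation defining A₁(K, v₀))
Homotopic : ∀ {v e} (K : Graph v e) (v₀ : Vertex K) → Loop K v₀ → Loop K v₀ → Set (v ⊔ e)
Homotopic K v₀ f g = BasedHomotopic K v₀ (fn f) (fn g)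

concatFn : ∀ {v e} {K : Graph v e} {v₀ : Vertex K} → Loop K v₀ → Loop K v₀ → ℤ → Vertex K
concatFn f g i =
  if i ≤ᵇ ℤ.0ℤ then fn f (i ℤ.+ + radius f) else fn g (i ℤ.- + radius g)

module Submission where

-- The isomorphism is induced by the two projections: they are graph maps out of G □ H, so they
-- carry homotopies to homotopies and concatenations to concatenations.  Conversely, loops u in G
-- and w in H combine into the staircase i ↦ (u ⌈i/2⌉, w ⌊i/2⌋), whose coordinates move in turn,
-- so it is a loop in G □ H; homotopies of u and of w lift to it one coordinate at a time.
-- Slowing a loop down gradually gives u ≃ u ∘ ⌈_/2⌉ and w ≃ w ∘ ⌊_/2⌋, whence surjectivity.
-- For injectivity, a loop f of G □ H is homotopic to f ∘ ⌊_/2⌋, which is pointwise adjacent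
-- to the staircase of its two projections.

open import Defs
open import Level using (_⊔_)
open import Data.Product using (Σ; _×_; _,_; ∃; ∃-syntax; proj₁; proj₂)
open import Relation.Binary.PropositionalEquality
  using (_≡_; _≗_; refl; sym; trans; cong; cong₂; subst; subst₂)
open import Data.Bool.Properties using (if-float)
open import Data.Nat as ℕ using (ℕ; zero; suc; _≤_; z≤n; s≤s; ⌊_/2⌋; ⌈_/2⌉)
import Data.Nat.Properties as ℕP
open import Data.Integer as ℤ using (ℤ; +_; -[1+_]; ∣_∣)
import Data.Integer.Properties as ℤP
open import Data.Fin as F using (Fin; toℕ; fromℕ)
open import Data.Sum using (_⊎_; inj₁; inj₂)
open import Function using (_∘_)

-- Adjacency need not be symmetric, so pointwise closeness of two rows of a
-- homotopy is recorded in both directions.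
record EqAdj⇔ {v e} (K : Graph v e) (x y : Vertex K) : Set (v ⊔ e) where
  constructor _⇄_
  field
    to   : EqAdj K x y
    from : EqAdj K y x
open EqAdj⇔ public

module _ {v e} {K : Graph v e} where

  EqAdj⇔-refl : ∀ {x y} → x ≡ y → EqAdj⇔ K x y
  EqAdj⇔-refl x≡y = inj₁ x≡y ⇄ inj₁ (sym x≡y)

  EqAdj⇔-sym : ∀ {x y} → EqAdj⇔ K x y → EqAdj⇔ K y x
  EqAdj⇔-sym (xy ⇄ yx) = yx ⇄ xy

  module _ {v' e'} {K' : Graph v' e'} where

    IsGraphMap-EqAdj⇔ : ∀ {f} → IsGraphMap K K' f → ∀ {x y} → EqAdj⇔ K x y → EqAdj⇔ K' (f x) (f y)
    IsGraphMap-EqAdj⇔ f-map (xy ⇄ yx) = f-map _ _ xy ⇄ f-map _ _ yx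

suc-EqAdj⇔ : ∀ i → EqAdj⇔ ℤG i (ℤ.suc i)
suc-EqAdj⇔ i = inj₂ (inj₁ 1+i≡i+1) ⇄ inj₂ (inj₂ 1+i≡i+1)
  where 1+i≡i+1 = ℤP.+-comm ℤ.1ℤ i

isGraphMap-fromℤ : ∀ {v e} (K : Graph v e) (f : ℤ → Vertex K) →
  (∀ i → EqAdj⇔ K (f i) (f (ℤ.suc i))) → IsGraphMap ℤG K f
isGraphMap-fromℤ K f steps i .i (inj₁ refl) = inj₁ refl
isGraphMap-fromℤ K f steps i j (inj₂ (inj₁ j≡i+1)) =
  subst (EqAdj K (f i) ∘ f) (trans (ℤP.+-comm ℤ.1ℤ i) (sym j≡i+1)) (to (steps i))
isGraphMap-fromℤ K f steps i j (inj₂ (inj₂ i≡j+1)) =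
  subst (λ k → EqAdj K (f k) (f j)) (trans (ℤP.+-comm ℤ.1ℤ j) (sym i≡j+1)) (from (steps j))

record IsBasedMap {v e} (K : Graph v e) (v₀ : Vertex K) (f : ℤ → Vertex K) : Set (v ⊔ e) where
  constructor _,_
  field
    isGraphMap : IsGraphMap ℤG K f
    isBased    : IsBased K v₀ f

loop-isBasedMap : ∀ {v e} {K : Graph v e} {v₀ : Vertex K} (f : Loop K v₀) → IsBasedMap K v₀ (fn f)
loop-isBasedMap f = isMap f , (radius f , based f)

toLoop : ∀ {v e} {K : Graph v e} {v₀ : Vertex K} {f} → IsBasedMap K v₀ f → Loop K v₀
toLoop {f = f} (f-map , r , f-based) = record { fn = f ; isMap = f-map ; radius = r ; based = f-based }

-- A based homotopy, read row by row: consecutive rows are pointwise close.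
data Chain {v e} (K : Graph v e) (v₀ : Vertex K) : (ℤ → Vertex K) → (ℤ → Vertex K) → Set (v ⊔ e) where
  done : ∀ {f} → IsBasedMap K v₀ f → Chain K v₀ f f
  step : ∀ {f g h} → IsBasedMap K v₀ f → (∀ i → EqAdj⇔ K (f i) (g i)) → Chain K v₀ g h → Chain K v₀ f h

module _ {v e} {K : Graph v e} {v₀ : Vertex K} where

  IsBasedMap-≗ : ∀ {f g} → IsBasedMap K v₀ f → f ≗ g → IsBasedMap K v₀ g
  IsBasedMap-≗ (f-map , r , f-based) f≗g =
    (λ i j ij → subst₂ (EqAdj K) (f≗g i) (f≗g j) (f-map i j ij)) ,
    (r , λ i r≤ → trans (sym (f≗g i)) (f-based i r≤))

  Chain-head : ∀ {f g} → Chain K v₀ f g → IsBasedMap K v₀ f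
  Chain-head (done f-ok) = f-ok
  Chain-head (step f-ok _ _) = f-ok

  infixr 5 _++_
  _++_ : ∀ {f g h} → Chain K v₀ f g → Chain K v₀ g h → Chain K v₀ f h
  done _ ++ c = c
  step f-ok fg c ++ c' = step f-ok fg (c ++ c')

  reverse : ∀ {f g} → Chain K v₀ f g → Chain K v₀ g f
  reverse c = go c (done (Chain-head c))
    where
    go : ∀ {f g h} → Chain K v₀ g h → Chain K v₀ g f → Chain K v₀ h f
    go (done _) acc = acc
    go (step _ gg' c) acc = go c (step (Chain-head c) (EqAdj⇔-sym ∘ gg') acc)

  ≗⇒Chain : ∀ {f g} → IsBasedMap K v₀ f → f ≗ g → Chain K v₀ f g
  ≗⇒Chain f-ok f≗g = step f-ok (EqAdj⇔-refl ∘ f≗g) (done (IsBasedMap-≗ f-ok f≗g))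

Chain-map : ∀ {v e v' e'} {K : Graph v e} {K' : Graph v' e'} {v₀ : Vertex K} {v₀' : Vertex K'}
  (Φ : (ℤ → Vertex K) → (ℤ → Vertex K')) →
  (∀ {f} → IsBasedMap K v₀ f → IsBasedMap K' v₀' (Φ f)) →
  (∀ {f g} → (∀ i → EqAdj⇔ K (f i) (g i)) → ∀ i → EqAdj⇔ K' (Φ f i) (Φ g i)) →
  ∀ {f g} → Chain K v₀ f g → Chain K' v₀' (Φ f) (Φ g)
Chain-map Φ Φ-ok Φ-close (done f-ok) = done (Φ-ok f-ok)
Chain-map Φ Φ-ok Φ-close (step f-ok fg c) = step (Φ-ok f-ok) (Φ-close fg) (Chain-map Φ Φ-ok Φ-close c)

row : ∀ {a b} {A : Set a} {B : Set b} {n} → (A × Fin n → B) → Fin n → A → B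
row h j i = h (i , j)

module GraphMapsFromℤ□I {v e} (K : Graph v e) where

  isGraphMap-□I : ∀ {m} (h : Vertex (ℤG □ I m) → Vertex K) →
    (∀ j → IsGraphMap ℤG K (row h j)) →
    (∀ j k → toℕ k ≡ suc (toℕ j) → ∀ i → EqAdj⇔ K (h (i , j)) (h (i , k))) →
    IsGraphMap (ℤG □ I m) K h
  isGraphMap-□I h rows cols (i , j) .(i , j) (inj₁ refl) = inj₁ refl
  isGraphMap-□I h rows cols (i , j) (i' , .j) (inj₂ (inj₁ (ii' , refl))) = rows j i i' (inj₂ ii')
  isGraphMap-□I h rows cols (i , j) (.i , k) (inj₂ (inj₂ (refl , inj₁ k≡1+j))) = to (cols j k k≡1+j i)
  isGraphMap-□I h rows cols (i , j) (.i , k) (inj₂ (inj₂ (refl , inj₂ j≡1+k))) = from (cols k j j≡1+k i)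

  row-isGraphMap : ∀ {m} (h : GraphMap (ℤG □ I m) K) j → IsGraphMap ℤG K (row (proj₁ h) j)
  row-isGraphMap (h , h-map) j i .i (inj₁ refl) = inj₁ refl
  row-isGraphMap (h , h-map) j i i' (inj₂ ii') = h-map (i , j) (i' , j) (inj₂ (inj₁ (ii' , refl)))

  column-EqAdj⇔ : ∀ {m} (h : GraphMap (ℤG □ I m) K) j k → toℕ k ≡ suc (toℕ j) →
    ∀ i → EqAdj⇔ K (proj₁ h (i , j)) (proj₁ h (i , k))
  column-EqAdj⇔ (h , h-map) j k k≡1+j i =
    h-map _ _ (inj₂ (inj₂ (refl , inj₁ k≡1+j))) ⇄ h-map _ _ (inj₂ (inj₂ (refl , inj₂ k≡1+j)))

module _ {v e} {K : Graph v e} {v₀ : Vertex K} where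
  open GraphMapsFromℤ□I K

  Chain⇒BasedHomotopic : ∀ {f g} → Chain K v₀ f g → BasedHomotopic K v₀ f g
  Chain⇒BasedHomotopic (done {f} (f-map , f-based)) =
    0 , (f ∘ proj₁ , isGraphMap-□I (f ∘ proj₁) (λ _ → f-map) no-cols)
      , (λ _ → f-based) , (λ _ → refl) , (λ _ → refl)
    where
    no-cols : ∀ j k → toℕ k ≡ suc (toℕ j) → ∀ i → EqAdj⇔ K (f i) (f i)
    no-cols F.zero F.zero ()
    no-cols _ (F.suc ())
  Chain⇒BasedHomotopic (step {f} (f-map , f-based) fg c)
    with Chain⇒BasedHomotopic c
  ... | m , (h , h-map) , h-based , h₀≗g , hₘ≗ =
    suc m , (h' , isGraphMap-□I h' rows cols) , h'-based , (λ _ → refl) , hₘ≗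
    where
    h' : Vertex (ℤG □ I (suc m)) → Vertex K
    h' (i , F.zero) = f i
    h' (i , F.suc j) = h (i , j)
    rows : ∀ j → IsGraphMap ℤG K (row h' j)
    rows F.zero = f-map
    rows (F.suc j) = row-isGraphMap (h , h-map) j
    cols : ∀ j k → toℕ k ≡ suc (toℕ j) → ∀ i → EqAdj⇔ K (h' (i , j)) (h' (i , k))
    cols F.zero (F.suc F.zero) _ i = subst (EqAdj⇔ K (f i)) (sym (h₀≗g i)) (fg i)
    cols F.zero (F.suc (F.suc _)) ()
    cols (F.suc j) (F.suc k) 1+k≡2+j = column-EqAdj⇔ (h , h-map) j k (ℕP.suc-injective 1+k≡2+j)
    h'-based : ∀ j → IsBased K v₀ (row h' j)
    h'-based F.zero = f-based
    h'-based (F.suc j) = h-based j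

  homotopy⇒Chain : ∀ m (h : GraphMap (ℤG □ I m) K) → (∀ j → IsBased K v₀ (row (proj₁ h) j)) →
    Chain K v₀ (row (proj₁ h) F.zero) (row (proj₁ h) (fromℕ m))
  homotopy⇒Chain zero h h-based = done (row-isGraphMap h F.zero , h-based F.zero)
  homotopy⇒Chain (suc m) (h , h-map) h-based =
    step (row-isGraphMap (h , h-map) F.zero , h-based F.zero)
         (column-EqAdj⇔ (h , h-map) F.zero (F.suc F.zero) refl)
         (homotopy⇒Chain m (h' , isGraphMap-□I h' rows cols) (h-based ∘ F.suc))
    where
    h' : Vertex (ℤG □ I m) → Vertex K
    h' (i , j) = h (i , F.suc j)
    rows : ∀ j → IsGraphMap ℤG K (row h' j)
    rows j = row-isGraphMap (h , h-map) (F.suc j)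
    cols : ∀ j k → toℕ k ≡ suc (toℕ j) → ∀ i → EqAdj⇔ K (h' (i , j)) (h' (i , k))
    cols j k k≡1+j = column-EqAdj⇔ (h , h-map) (F.suc j) (F.suc k) (cong suc k≡1+j)

  BasedHomotopic⇒Chain : ∀ {f g} → IsBasedMap K v₀ f → BasedHomotopic K v₀ f g → Chain K v₀ f g
  BasedHomotopic⇒Chain f-ok (m , h , h-based , h₀≗f , hₘ≗g) =
    ≗⇒Chain f-ok (sym ∘ h₀≗f)
    ++ homotopy⇒Chain m h h-based
    ++ ≗⇒Chain (row-isGraphMap h (fromℕ m) , h-based (fromℕ m)) hₘ≗g

  BasedHomotopic-reflexive : ∀ {f g} → IsBasedMap K v₀ f → f ≗ g → BasedHomotopic K v₀ f g
  BasedHomotopic-reflexive f-ok f≗g = Chain⇒BasedHomotopic (≗⇒Chain f-ok f≗g)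

module _ {v e v' e'} {K : Graph v e} {K' : Graph v' e'}
         (P : Vertex K → Vertex K') (P-map : IsGraphMap K K' P) where

  ∘-isGraphMap : ∀ {f} → IsGraphMap ℤG K f → IsGraphMap ℤG K' (P ∘ f)
  ∘-isGraphMap f-map i j ij = P-map _ _ (f-map i j ij)

  module _ {v₀ : Vertex K} where

    ∘-based : ∀ {f r} → BasedWithRadius K v₀ f r → BasedWithRadius K' (P v₀) (P ∘ f) r
    ∘-based f-based i r≤ = cong P (f-based i r≤)

    Loop-map : Loop K v₀ → Loop K' (P v₀)
    Loop-map f = record
      { fn = P ∘ fn f ; isMap = ∘-isGraphMap (isMap f) ; radius = radius f ; based = ∘-based (based f) }

    IsBasedMap-map : ∀ {f} → IsBasedMap K v₀ f → IsBasedMap K' (P v₀) (P ∘ f)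
    IsBasedMap-map (f-map , r , f-based) = ∘-isGraphMap f-map , r , ∘-based f-based

    BasedHomotopic-map : ∀ {f g} → BasedHomotopic K v₀ f g → BasedHomotopic K' (P v₀) (P ∘ f) (P ∘ g)
    BasedHomotopic-map (m , (h , h-map) , h-based , h₀≗f , hₘ≗g) =
      m , (P ∘ h , λ x y xy → P-map _ _ (h-map x y xy))
        , (λ j → proj₁ (h-based j) , ∘-based (proj₂ (h-based j)))
        , cong P ∘ h₀≗f , cong P ∘ hₘ≗g

    Loop-map-concatFn : ∀ f f' (p : Loop K v₀) → fn p ≗ concatFn f f' →
      BasedHomotopic K' (P v₀) (fn (Loop-map p)) (concatFn (Loop-map f) (Loop-map f'))
    Loop-map-concatFn f f' p p≗f·f' =
      BasedHomotopic-reflexive (loop-isBasedMap (Loop-map p))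
        (λ i → trans (cong P (p≗f·f' i)) (if-float P (i ℤ.≤ᵇ ℤ.0ℤ)))

infix 4 _≼_
_≼_ : ℕ → ℕ → Set
m ≼ n = n ≡ m ⊎ n ≡ suc m

≼-suc : ∀ {m n} → m ≼ n → suc m ≼ suc n
≼-suc (inj₁ n≡m) = inj₁ (cong suc n≡m)
≼-suc (inj₂ n≡1+m) = inj₂ (cong suc n≡1+m)

≼-flip : ∀ {m n} → m ≼ n → n ≼ suc m
≼-flip (inj₁ refl) = inj₂ refl
≼-flip (inj₂ refl) = inj₁ refl

IsLazyWalk : (ℕ → ℕ) → Set
IsLazyWalk s = s 0 ≡ 0 × (∀ k → s k ≼ s (suc k))

Diverges : (ℕ → ℕ) → Set
Diverges s = ∀ r → ∃[ R ] (∀ k → R ≤ k → r ≤ s k)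

oddExt : (ℕ → ℕ) → ℤ → ℤ
oddExt s (+ k) = + s k
oddExt s -[1+ k ] = ℤ.- (+ s (suc k))

∣oddExt∣ : ∀ s i → ∣ oddExt s i ∣ ≡ s ∣ i ∣
∣oddExt∣ s (+ k) = refl
∣oddExt∣ s -[1+ k ] = ℤP.∣-i∣≡∣i∣ (+ s (suc k))

oddExt-cong : ∀ s t i → s ∣ i ∣ ≡ t ∣ i ∣ → oddExt s i ≡ oddExt t i
oddExt-cong s t (+ k) eq = cong +_ eq
oddExt-cong s t -[1+ k ] eq = cong (ℤ.-_ ∘ +_) eq

oddExt-suc-neg : ∀ s → s 0 ≡ 0 → ∀ k → oddExt s (ℤ.suc -[1+ k ]) ≡ ℤ.- (+ s k)
oddExt-suc-neg s s0≡0 zero rewrite s0≡0 = refl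
oddExt-suc-neg s s0≡0 (suc k) = refl

≼⇒EqAdj⇔⁺ : ∀ {m n} → m ≼ n → EqAdj⇔ ℤG (+ m) (+ n)
≼⇒EqAdj⇔⁺ (inj₁ refl) = EqAdj⇔-refl refl
≼⇒EqAdj⇔⁺ {m} (inj₂ refl) = suc-EqAdj⇔ (+ m)

≼⇒EqAdj⇔⁻ : ∀ {m n} → m ≼ n → EqAdj⇔ ℤG (ℤ.- (+ n)) (ℤ.- (+ m))
≼⇒EqAdj⇔⁻ (inj₁ refl) = EqAdj⇔-refl refl
≼⇒EqAdj⇔⁻ {m} (inj₂ refl) = subst (EqAdj⇔ ℤG -[1+ m ]) (ℤP.1-[1+n]≡-n m) (suc-EqAdj⇔ -[1+ m ])

oddExt-isGraphMap : ∀ {s} → IsLazyWalk s → IsGraphMap ℤG ℤG (oddExt s)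
oddExt-isGraphMap {s} (s0≡0 , s-step) = isGraphMap-fromℤ ℤG (oddExt s) steps
  where
  steps : ∀ i → EqAdj⇔ ℤG (oddExt s i) (oddExt s (ℤ.suc i))
  steps (+ k) = ≼⇒EqAdj⇔⁺ (s-step k)
  steps -[1+ k ] =
    subst (EqAdj⇔ ℤG (oddExt s -[1+ k ])) (sym (oddExt-suc-neg s s0≡0 k)) (≼⇒EqAdj⇔⁻ (s-step k))

oddExt-EqAdj⇔ : ∀ {s t} → (∀ k → s k ≼ t k) → ∀ i → EqAdj⇔ ℤG (oddExt s i) (oddExt t i)
oddExt-EqAdj⇔ s≼t (+ k) = ≼⇒EqAdj⇔⁺ (s≼t k)
oddExt-EqAdj⇔ s≼t -[1+ k ] = EqAdj⇔-sym (≼⇒EqAdj⇔⁻ (s≼t (suc k)))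

module _ {v e} {K : Graph v e} {v₀ : Vertex K} where

  ∘oddExt-outside : ∀ {f r} → BasedWithRadius K v₀ f r → ∀ s i → r ≤ s ∣ i ∣ → f (oddExt s i) ≡ v₀
  ∘oddExt-outside {r = r} f-based s i r≤ = f-based _ (subst (r ≤_) (sym (∣oddExt∣ s i)) r≤)

  ∘oddExt-based : ∀ {f r R s} → BasedWithRadius K v₀ f r → (∀ k → R ≤ k → r ≤ s k) →
    BasedWithRadius K v₀ (f ∘ oddExt s) R
  ∘oddExt-based {s = s} f-based far i R≤∣i∣ = ∘oddExt-outside f-based s i (far ∣ i ∣ R≤∣i∣)

  ∘oddExt-isBasedMap : ∀ {f s} → IsBasedMap K v₀ f → IsLazyWalk s → Diverges s →
    IsBasedMap K v₀ (f ∘ oddExt s)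
  ∘oddExt-isBasedMap (f-map , r , f-based) s-walk s-diverges =
    (λ i j ij → f-map _ _ (oddExt-isGraphMap s-walk i j ij)) ,
    (proj₁ (s-diverges r) , ∘oddExt-based f-based (proj₂ (s-diverges r)))

⌊n/2⌋≼⌈n/2⌉ : ∀ n → ⌊ n /2⌋ ≼ ⌈ n /2⌉
⌊n/2⌋≼⌈n/2⌉ zero = inj₁ refl
⌊n/2⌋≼⌈n/2⌉ (suc zero) = inj₂ refl
⌊n/2⌋≼⌈n/2⌉ (suc (suc n)) = ≼-suc (⌊n/2⌋≼⌈n/2⌉ n)

⌊/2⌋-isLazyWalk : IsLazyWalk ⌊_/2⌋
⌊/2⌋-isLazyWalk = refl , ⌊n/2⌋≼⌈n/2⌉

⌈/2⌉-isLazyWalk : IsLazyWalk ⌈_/2⌉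
⌈/2⌉-isLazyWalk = refl , ≼-flip ∘ ⌊n/2⌋≼⌈n/2⌉

⌊/2⌋-diverges : Diverges ⌊_/2⌋
⌊/2⌋-diverges r = r ℕ.+ r , λ k r+r≤k →
  subst (_≤ ⌊ k /2⌋) (sym (ℕP.n≡⌊n+n/2⌋ r)) (ℕP.⌊n/2⌋-mono r+r≤k)

⌈/2⌉-diverges : Diverges ⌈_/2⌉
⌈/2⌉-diverges r = r ℕ.+ r , λ k r+r≤k →
  ℕP.≤-trans (proj₂ (⌊/2⌋-diverges r) k r+r≤k) (ℕP.⌊n/2⌋≤⌈n/2⌉ k)

⌈/2⌉-⌊/2⌋-alternate : ∀ i →
    (oddExt ⌈_/2⌉ i ≡ oddExt ⌈_/2⌉ (ℤ.suc i) × EqAdj⇔ ℤG (oddExt ⌊_/2⌋ i) (oddExt ⌊_/2⌋ (ℤ.suc i)))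
  ⊎ (EqAdj⇔ ℤG (oddExt ⌈_/2⌉ i) (oddExt ⌈_/2⌉ (ℤ.suc i)) × oddExt ⌊_/2⌋ i ≡ oddExt ⌊_/2⌋ (ℤ.suc i))
⌈/2⌉-⌊/2⌋-alternate (+ k) with ⌊n/2⌋≼⌈n/2⌉ k
... | inj₁ ⌈k⌉≡⌊k⌋ = inj₂ (≼⇒EqAdj⇔⁺ (≼-flip (⌊n/2⌋≼⌈n/2⌉ k)) , cong +_ (sym ⌈k⌉≡⌊k⌋))
... | inj₂ ⌈k⌉≡1+⌊k⌋ = inj₁ (cong +_ ⌈k⌉≡1+⌊k⌋ , ≼⇒EqAdj⇔⁺ (⌊n/2⌋≼⌈n/2⌉ k))
⌈/2⌉-⌊/2⌋-alternate -[1+ zero ] = inj₂ (suc-EqAdj⇔ -[1+ 0 ] , refl)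
⌈/2⌉-⌊/2⌋-alternate -[1+ suc k ] with ⌊n/2⌋≼⌈n/2⌉ (suc k)
... | inj₁ ⌈k⌉≡⌊k⌋ = inj₂ (≼⇒EqAdj⇔⁻ (≼-flip (⌊n/2⌋≼⌈n/2⌉ (suc k))) , cong (ℤ.-_ ∘ +_) ⌈k⌉≡⌊k⌋)
... | inj₂ ⌈k⌉≡1+⌊k⌋ = inj₁ (cong (ℤ.-_ ∘ +_) (sym ⌈k⌉≡1+⌊k⌋) , ≼⇒EqAdj⇔⁻ (⌊n/2⌋≼⌈n/2⌉ (suc k)))

-- slow n agrees with ⌊_/2⌋ on [0, 2n] and with _∸ n beyond: an interpolation from
-- the identity (n = 0) to ⌊_/2⌋ (n large) in steps of size at most one.
slow : ℕ → ℕ → ℕ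
slow zero k = k
slow (suc n) zero = zero
slow (suc n) (suc zero) = zero
slow (suc n) (suc (suc k)) = suc (slow n k)

slow-isLazyWalk : ∀ n → IsLazyWalk (slow n)
slow-isLazyWalk n = slow-zero n , slow-step n
  where
  slow-zero : ∀ n → slow n 0 ≡ 0
  slow-zero zero = refl
  slow-zero (suc n) = refl
  slow-step : ∀ n k → slow n k ≼ slow n (suc k)
  slow-step zero k = inj₂ refl
  slow-step (suc n) zero = inj₁ refl
  slow-step (suc n) (suc zero) = inj₂ (cong suc (slow-zero n))
  slow-step (suc n) (suc (suc k)) = ≼-suc (slow-step n k)

slow-suc≼slow : ∀ n k → slow (suc n) k ≼ slow n k
slow-suc≼slow zero zero = inj₁ refl
slow-suc≼slow zero (suc zero) = inj₂ refl
slow-suc≼slow zero (suc (suc k)) = inj₂ refl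
slow-suc≼slow (suc n) zero = inj₁ refl
slow-suc≼slow (suc n) (suc zero) = inj₁ refl
slow-suc≼slow (suc n) (suc (suc k)) = ≼-suc (slow-suc≼slow n k)

≤slow+ : ∀ n k → k ≤ slow n k ℕ.+ n
≤slow+ zero k = ℕP.m≤m+n k 0
≤slow+ (suc n) zero = z≤n
≤slow+ (suc n) (suc zero) = s≤s z≤n
≤slow+ (suc n) (suc (suc k)) =
  subst (suc (suc k) ≤_) (cong suc (sym (ℕP.+-suc (slow n k) n))) (s≤s (s≤s (≤slow+ n k)))

slow-diverges : ∀ n → Diverges (slow n)
slow-diverges n r = r ℕ.+ n , λ k r+n≤k →
  ℕP.+-cancelʳ-≤ n r (slow n k) (ℕP.≤-trans r+n≤k (≤slow+ n k))

slow≡⌊/2⌋⊎far : ∀ n k → slow n k ≡ ⌊ k /2⌋ ⊎ (n ≤ ⌊ k /2⌋ × n ≤ slow n k)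
slow≡⌊/2⌋⊎far zero k = inj₂ (z≤n , z≤n)
slow≡⌊/2⌋⊎far (suc n) zero = inj₁ refl
slow≡⌊/2⌋⊎far (suc n) (suc zero) = inj₁ refl
slow≡⌊/2⌋⊎far (suc n) (suc (suc k)) with slow≡⌊/2⌋⊎far n k
... | inj₁ eq = inj₁ (cong suc eq)
... | inj₂ (n≤⌊k⌋ , n≤slow) = inj₂ (s≤s n≤⌊k⌋ , s≤s n≤slow)

module _ {v e} {K : Graph v e} {v₀ : Vertex K} where

  slowdown : ∀ {f} → IsBasedMap K v₀ f → Chain K v₀ f (f ∘ oddExt ⌊_/2⌋)
  slowdown {f} f-ok@(f-map , r , f-based) =
    ≗⇒Chain f-ok row₀ ++ rows r ++ ≗⇒Chain (row-ok r) rowᵣ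
    where
    row-ok : ∀ n → IsBasedMap K v₀ (f ∘ oddExt (slow n))
    row-ok n = ∘oddExt-isBasedMap f-ok (slow-isLazyWalk n) (slow-diverges n)

    rows : ∀ n → Chain K v₀ (f ∘ oddExt (slow 0)) (f ∘ oddExt (slow n))
    rows zero = done (row-ok 0)
    rows (suc n) = rows n ++ step (row-ok n) close (done (row-ok (suc n)))
      where
      close : ∀ i → EqAdj⇔ K (f (oddExt (slow n) i)) (f (oddExt (slow (suc n)) i))
      close i = IsGraphMap-EqAdj⇔ f-map (EqAdj⇔-sym (oddExt-EqAdj⇔ (slow-suc≼slow n) i))

    row₀ : f ≗ f ∘ oddExt (slow 0)
    row₀ (+ k) = refl
    row₀ -[1+ k ] = refl

    rowᵣ : f ∘ oddExt (slow r) ≗ f ∘ oddExt ⌊_/2⌋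
    rowᵣ i with slow≡⌊/2⌋⊎far r ∣ i ∣
    ... | inj₁ eq = cong f (oddExt-cong (slow r) ⌊_/2⌋ i eq)
    ... | inj₂ (r≤⌊i⌋ , r≤slow) =
      trans (∘oddExt-outside {K = K} f-based (slow r) i r≤slow)
            (sym (∘oddExt-outside {K = K} f-based ⌊_/2⌋ i r≤⌊i⌋))

  slowdown⌈⌉ : ∀ {f} → IsBasedMap K v₀ f → Chain K v₀ f (f ∘ oddExt ⌈_/2⌉)
  slowdown⌈⌉ {f} f-ok =
    slowdown f-ok
    ++ step (∘oddExt-isBasedMap f-ok ⌊/2⌋-isLazyWalk ⌊/2⌋-diverges)
            (IsGraphMap-EqAdj⇔ (IsBasedMap.isGraphMap f-ok) ∘ oddExt-EqAdj⇔ ⌊n/2⌋≼⌈n/2⌉)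
            (done (∘oddExt-isBasedMap f-ok ⌈/2⌉-isLazyWalk ⌈/2⌉-diverges))

module Box {v e v' e'} (G : Graph v e) (H : Graph v' e') (g₀ : Vertex G) (h₀ : Vertex H) where

  proj₁-isGraphMap : IsGraphMap (G □ H) G proj₁
  proj₁-isGraphMap x .x (inj₁ refl) = inj₁ refl
  proj₁-isGraphMap x y (inj₂ (inj₁ (x₁y₁ , _))) = inj₂ x₁y₁
  proj₁-isGraphMap x y (inj₂ (inj₂ (x₁≡y₁ , _))) = inj₁ x₁≡y₁

  proj₂-isGraphMap : IsGraphMap (G □ H) H proj₂
  proj₂-isGraphMap x .x (inj₁ refl) = inj₁ refl
  proj₂-isGraphMap x y (inj₂ (inj₁ (_ , x₂≡y₂))) = inj₁ x₂≡y₂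
  proj₂-isGraphMap x y (inj₂ (inj₂ (_ , x₂y₂))) = inj₂ x₂y₂

  loop₁ : Loop (G □ H) (g₀ , h₀) → Loop G g₀
  loop₁ = Loop-map proj₁ proj₁-isGraphMap

  loop₂ : Loop (G □ H) (g₀ , h₀) → Loop H h₀
  loop₂ = Loop-map proj₂ proj₂-isGraphMap

  □-EqAdj⇔ : ∀ {x x' y y'} → (x ≡ x' × EqAdj⇔ H y y') ⊎ (EqAdj⇔ G x x' × y ≡ y') →
    EqAdj⇔ (G □ H) (x , y) (x' , y')
  □-EqAdj⇔ (inj₁ (refl , yy' ⇄ y'y)) = alongH yy' ⇄ alongH y'y
    where
    alongH : ∀ {x y y'} → EqAdj H y y' → EqAdj (G □ H) (x , y) (x , y')
    alongH (inj₁ refl) = inj₁ refl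
    alongH (inj₂ yy') = inj₂ (inj₂ (refl , yy'))
  □-EqAdj⇔ (inj₂ (xx' ⇄ x'x , refl)) = alongG xx' ⇄ alongG x'x
    where
    alongG : ∀ {x x' y} → EqAdj G x x' → EqAdj (G □ H) (x , y) (x' , y)
    alongG (inj₁ refl) = inj₁ refl
    alongG (inj₂ xx') = inj₂ (inj₁ (xx' , refl))

  staircase : (ℤ → Vertex G) → (ℤ → Vertex H) → ℤ → Vertex (G □ H)
  staircase u w i = u (oddExt ⌈_/2⌉ i) , w (oddExt ⌊_/2⌋ i)

  staircase-isBasedMap : ∀ {u w} → IsBasedMap G g₀ u → IsBasedMap H h₀ w →
    IsBasedMap (G □ H) (g₀ , h₀) (staircase u w)
  staircase-isBasedMap {u} {w} u-ok@(u-map , _) w-ok@(w-map , _) =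
    isGraphMap-fromℤ (G □ H) (staircase u w) steps , Rᵤ ℕ.⊔ R_w , staircase-based
    where
    u′-based = IsBasedMap.isBased (∘oddExt-isBasedMap u-ok ⌈/2⌉-isLazyWalk ⌈/2⌉-diverges)
    w′-based = IsBasedMap.isBased (∘oddExt-isBasedMap w-ok ⌊/2⌋-isLazyWalk ⌊/2⌋-diverges)
    Rᵤ = proj₁ u′-based
    R_w = proj₁ w′-based
    steps : ∀ i → EqAdj⇔ (G □ H) (staircase u w i) (staircase u w (ℤ.suc i))
    steps i with ⌈/2⌉-⌊/2⌋-alternate i
    ... | inj₁ (⌈⌉≡ , ⌊⌋-adj) = □-EqAdj⇔ (inj₁ (cong u ⌈⌉≡ , IsGraphMap-EqAdj⇔ w-map ⌊⌋-adj))
    ... | inj₂ (⌈⌉-adj , ⌊⌋≡) = □-EqAdj⇔ (inj₂ (IsGraphMap-EqAdj⇔ u-map ⌈⌉-adj , cong w ⌊⌋≡))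
    staircase-based : BasedWithRadius (G □ H) (g₀ , h₀) (staircase u w) (Rᵤ ℕ.⊔ R_w)
    staircase-based i R≤ =
      cong₂ _,_ (proj₂ u′-based i (ℕP.≤-trans (ℕP.m≤m⊔n Rᵤ R_w) R≤))
                (proj₂ w′-based i (ℕP.≤-trans (ℕP.m≤n⊔m Rᵤ R_w) R≤))

  staircase-congˡ : ∀ {u u' w} → Chain G g₀ u u' → IsBasedMap H h₀ w →
    Chain (G □ H) (g₀ , h₀) (staircase u w) (staircase u' w)
  staircase-congˡ {w = w} u≃u' w-ok =
    Chain-map (λ u → staircase u w) (λ u-ok → staircase-isBasedMap u-ok w-ok)
              (λ close i → □-EqAdj⇔ (inj₂ (close (oddExt ⌈_/2⌉ i) , refl))) u≃u'

  staircase-congʳ : ∀ {u w w'} → IsBasedMap G g₀ u → Chain H h₀ w w' →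
    Chain (G □ H) (g₀ , h₀) (staircase u w) (staircase u w')
  staircase-congʳ {u = u} u-ok w≃w' =
    Chain-map (staircase u) (staircase-isBasedMap u-ok)
              (λ close i → □-EqAdj⇔ (inj₁ (refl , close (oddExt ⌊_/2⌋ i)))) w≃w'

  ≃staircase : ∀ {f} → IsBasedMap (G □ H) (g₀ , h₀) f →
    Chain (G □ H) (g₀ , h₀) f (staircase (proj₁ ∘ f) (proj₂ ∘ f))
  ≃staircase {f} f-ok =
    slowdown f-ok
    ++ step (∘oddExt-isBasedMap f-ok ⌊/2⌋-isLazyWalk ⌊/2⌋-diverges) close
            (done (staircase-isBasedMap (IsBasedMap-map proj₁ proj₁-isGraphMap f-ok)
                                        (IsBasedMap-map proj₂ proj₂-isGraphMap f-ok)))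
    where
    f₁-map : IsGraphMap ℤG G (proj₁ ∘ f)
    f₁-map = ∘-isGraphMap proj₁ proj₁-isGraphMap (IsBasedMap.isGraphMap f-ok)
    close : ∀ i → EqAdj⇔ (G □ H) (f (oddExt ⌊_/2⌋ i)) (staircase (proj₁ ∘ f) (proj₂ ∘ f) i)
    close i = □-EqAdj⇔ (inj₂ (IsGraphMap-EqAdj⇔ f₁-map (oddExt-EqAdj⇔ ⌊n/2⌋≼⌈n/2⌉ i) , refl))

  Homotopic-proj⇒Homotopic : ∀ f f' →
    Homotopic G g₀ (loop₁ f) (loop₁ f') → Homotopic H h₀ (loop₂ f) (loop₂ f') →
    Homotopic (G □ H) (g₀ , h₀) f f'
  Homotopic-proj⇒Homotopic f f' f₁≃f₁' f₂≃f₂' =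
    Chain⇒BasedHomotopic
      ( ≃staircase (loop-isBasedMap f)
     ++ staircase-congˡ (BasedHomotopic⇒Chain (loop-isBasedMap (loop₁ f)) f₁≃f₁')
                        (loop-isBasedMap (loop₂ f))
     ++ staircase-congʳ (loop-isBasedMap (loop₁ f'))
                        (BasedHomotopic⇒Chain (loop-isBasedMap (loop₂ f)) f₂≃f₂')
     ++ reverse (≃staircase (loop-isBasedMap f')))

  proj-surjective : ∀ (a : Loop G g₀) (b : Loop H h₀) → ∃[ f ]
    (Homotopic G g₀ (loop₁ f) a × Homotopic H h₀ (loop₂ f) b)
  proj-surjective a b =
    toLoop (staircase-isBasedMap (loop-isBasedMap a) (loop-isBasedMap b)) ,
    Chain⇒BasedHomotopic (reverse (slowdown⌈⌉ (loop-isBasedMap a))) ,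
    Chain⇒BasedHomotopic (reverse (slowdown (loop-isBasedMap b)))

lemma4p4 : ∀ {v e v' e'} (G : Graph v e) (H : Graph v' e') →
    IsConnected G → IsSimple G → IsLocallyFinite G →
    IsConnected H → IsSimple H → IsLocallyFinite H →
    (g₀ : Vertex G) (h₀ : Vertex H) →
    Σ (Loop (G □ H) (g₀ , h₀) → Loop G g₀ × Loop H h₀) λ φ →
        (∀ f f' → Homotopic (G □ H) (g₀ , h₀) f f' →
           Homotopic G g₀ (proj₁ (φ f)) (proj₁ (φ f'))
           × Homotopic H h₀ (proj₂ (φ f)) (proj₂ (φ f')))
      × (∀ f f' (p : Loop (G □ H) (g₀ , h₀)) → (∀ i → fn p i ≡ concatFn f f' i) →
           BasedHomotopic G g₀ (fn (proj₁ (φ p))) (concatFn (proj₁ (φ f)) (proj₁ (φ f')))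
           × BasedHomotopic H h₀ (fn (proj₂ (φ p))) (concatFn (proj₂ (φ f)) (proj₂ (φ f'))))
      × (∀ f f' → Homotopic G g₀ (proj₁ (φ f)) (proj₁ (φ f'))
           → Homotopic H h₀ (proj₂ (φ f)) (proj₂ (φ f'))
           → Homotopic (G □ H) (g₀ , h₀) f f')
      × (∀ (a : Loop G g₀) (b : Loop H h₀) → ∃[ f ]
           (Homotopic G g₀ (proj₁ (φ f)) a × Homotopic H h₀ (proj₂ (φ f)) b))
lemma4p4 G H _ _ _ _ _ _ g₀ h₀ =
  (λ f → loop₁ f , loop₂ f) ,
  (λ f f' f≃f' → BasedHomotopic-map proj₁ proj₁-isGraphMap f≃f' ,
                 BasedHomotopic-map proj₂ proj₂-isGraphMap f≃f') ,
  (λ f f' p p≗f·f' → Loop-map-concatFn proj₁ proj₁-isGraphMap f f' p p≗f·f' ,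
                     Loop-map-concatFn proj₂ proj₂-isGraphMap f f' p p≗f·f') ,
  Homotopic-proj⇒Homotopic ,
  proj-surjective
  where open Box G H g₀ h₀
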